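{- There is a constant $c>0$ such that for every integer $k\ge2$, the class $\Delta_k$ contains at least $2^{c\cdot 3^k}$ pairwise non-isomorphic graphs; that is, $\Delta_k$ has at least $2^{\Omega(3^k)}$ non-isomorphic graphs.
   Context: Graphs are finite and simple. A delta composition of graphs $G_1,G_2,G_3$ is obtained from their disjoint union by choosing $v_i\in V(G_i)$ for $i=1,2,3$ and adding the edges of the triangle $v_1v_2v_3$. $\Delta_0=\{K_2\}$. For $i\ge1$, $\Delta_i$ is the set of all delta compositions of three (not necessarily distinct) graphs in $\Delta_{i-1}$, with graphs considered up to isomorphism. -}

module Defs where

open import Data.Nat using (ℕ; zero; suc; _+_)
open import Data.Bool using (Bool; true; false; _∧_; _∨_; not)
open import Data.Fin using (Fin; splitAt; _↑ˡ_; _↑ʳ_; _≟_)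
open import Data.Sum using (_⊎_; inj₁; inj₂)
open import Data.Product using (Σ; _×_)
open import Relation.Nullary.Decidable using (⌊_⌋)
open import Relation.Binary.PropositionalEquality using (_≡_)
open import Function.Bundles using (_↔_; Inverse)

-- A (finite) graph: vertex set Fin order, Boolean adjacency.
-- Symmetry / irreflexivity are not stored: every graph in Δ_k is
-- isomorphic to one built from K₂ by delta compositions, hence simple.
record Graph : Set where
  field
    order : ℕ
    adj   : Fin order → Fin order → Bool
open Graph public

_≅_ : Graph → Graph → Set
G ≅ H = Σ (Fin (order G) ↔ Fin (order H)) λ σ →
          ∀ x y → adj G x y ≡ adj H (Inverse.to σ x) (Inverse.to σ y)

K₂ : Graph
K₂ = record { order = 2 ; adj = λ x y → not ⌊ x ≟ y ⌋ }

unionAdj : (G H : Graph) → Fin (order G) ⊎ Fin (order H) → Fin (order G) ⊎ Fin (order H) → Bool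
unionAdj G H (inj₁ x) (inj₁ y) = adj G x y
unionAdj G H (inj₂ x) (inj₂ y) = adj H x y
unionAdj G H (inj₁ x) (inj₂ y) = false
unionAdj G H (inj₂ x) (inj₁ y) = false

_⊕_ : Graph → Graph → Graph
G ⊕ H = record { order = order G + order H
               ; adj = λ x y → unionAdj G H (splitAt (order G) x) (splitAt (order G) y) }

-- Delta composition of G₁, G₂, G₃ at v₁, v₂, v₃: disjoint union
-- (G₁ ⊕ G₂) ⊕ G₃ plus the triangle on the images of v₁, v₂, v₃.
delta : (G₁ : Graph) → Fin (order G₁) → (G₂ : Graph) → Fin (order G₂) →
        (G₃ : Graph) → Fin (order G₃) → Graph
delta G₁ v₁ G₂ v₂ G₃ v₃ =
  record { order = order U
         ; adj = λ x y → adj U x y ∨ (isT x ∧ isT y ∧ not ⌊ x ≟ y ⌋) }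
  where
  U : Graph
  U = (G₁ ⊕ G₂) ⊕ G₃
  w₁ w₂ w₃ : Fin (order U)
  w₁ = (v₁ ↑ˡ order G₂) ↑ˡ order G₃
  w₂ = (order G₁ ↑ʳ v₂) ↑ˡ order G₃
  w₃ = (order G₁ + order G₂) ↑ʳ v₃
  isT : Fin (order U) → Bool
  isT x = ⌊ x ≟ w₁ ⌋ ∨ ⌊ x ≟ w₂ ⌋ ∨ ⌊ x ≟ w₃ ⌋

InΔ : ℕ → Graph → Set
InΔ zero G = G ≅ K₂
InΔ (suc i) G =
  Σ Graph λ G₁ → Σ Graph λ G₂ → Σ Graph λ G₃ →
  InΔ i G₁ × InΔ i G₂ × InΔ i G₃ ×
  Σ (Fin (order G₁)) λ v₁ → Σ (Fin (order G₂)) λ v₂ → Σ (Fin (order G₃)) λ v₃ →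
  G ≅ delta G₁ v₁ G₂ v₂ G₃ v₃

module Submission where

-- A connected graph of Δ_k with maximum degree D attained at a chosen root is "rooted" here.
-- Gluing three rooted graphs at their roots gives a rooted graph of Δ_(k+1) with parameter
-- D + 2 whose triangle consists exactly of the vertices of degree D + 2.  The edges not
-- joining two such vertices fall apart into the three pieces, so any isomorphism between two
-- such compositions maps triangle to triangle and restricts to rooted isomorphisms between
-- the pieces: a composition determines its pieces up to order.  Taking the root piece from a
-- family of pairwise non-isomorphic rooted graphs split into two classes, and the other two
-- pieces one from each class, cubes the size of the family at every level.  Forgetting roots,
-- a composition P ⊙ Q ⊙ Q with P and Q from different classes is still determined by (P, Q).
-- Starting from 2 × 2 rooted graphs in Δ₃, built from three graphs of Δ₂ told apart by degree
-- counts, this gives (2 ^ 3 ^ i)² non-isomorphic graphs in Δ_(4+i); hence c = 1/81 works.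

open import Defs
open import Data.Bool using (Bool; true; false; T; _∧_; _∨_; not; if_then_else_)
open import Data.Bool.Properties using (∨-identityʳ; ∧-identityʳ; T-∧)
open import Data.Fin using (Fin; splitAt; _↑ˡ_; _↑ʳ_; _≟_)
import Data.Fin as F
open import Data.Fin.Patterns using (0F; 1F; 2F)
open import Data.Fin.Properties
  using (all?; *↔×; suc-injective; splitAt-↑ˡ; splitAt-↑ʳ; splitAt⁻¹-↑ˡ; splitAt⁻¹-↑ʳ)
open import Data.List using (List; length; tabulate; _∷_; [])
open import Data.List.Properties using (length-tabulate)
open import Data.List.Relation.Unary.All using (All; _∷_; [])
import Data.List.Relation.Unary.All.Properties as All
open import Data.List.Relation.Unary.AllPairs using (AllPairs; _∷_; [])
import Data.List.Relation.Unary.AllPairs.Properties as AllPairs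
open import Data.Nat using (ℕ; zero; suc; _+_; _*_; _^_; _≤_; _≤?_; _≡ᵇ_; s≤s; z≤n)
open import Data.Nat.Properties
  using (≤-refl; ≤-trans; ≤-reflexive; n≤1+n; 1+n≰n; m≤n+m; m≤m+n; ≤ᵇ⇒≤; +-assoc; +-comm;
         +-identityʳ; *-identityˡ; *-comm; *-monoˡ-≤; ^-monoʳ-≤; ^-*-assoc; ^-distribˡ-+-*;
         +-0-commutativeMonoid; module ≤-Reasoning)
open import Algebra.Properties.CommutativeMonoid.Sum +-0-commutativeMonoid
  using (sum; sum-cong-≗; sum-permute; sum-replicate-zero)
open import Data.Product using (Σ; _×_; _,_; proj₁; proj₂; ∃; ∃₂)
import Data.Product as Product
open import Data.Product.Algebra using (×-assoc)
open import Data.Product.Function.NonDependent.Propositional using (_×-↔_)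
open import Data.Sum using (_⊎_; inj₁; inj₂)
open import Data.Unit using (⊤; tt)
open import Function using (_∘_; const)
open import Function.Bundles using (_↔_; Inverse; mk↔ₛ′; Equivalence; Injection)
open import Function.Construct.Composition using (_↔-∘_)
open import Function.Construct.Identity using (↔-id)
open import Function.Construct.Symmetry using (↔-sym)
open import Function.Properties.Inverse using (Inverse⇒Injection)
open import Level using (0ℓ)
open import Relation.Binary.Construct.Closure.ReflexiveTransitive using (Star; ε; _◅_; _◅◅_; gmap)
open import Relation.Binary.PropositionalEquality
open import Relation.Nullary using (¬_)
open import Relation.Nullary.Decidable
  using (⌊_⌋; yes; no; isYes≗does; dec-true; dec-false; toWitness)
open import Relation.Nullary.Negation using (contradiction)

indicator : Bool → ℕ
indicator b = if b then 1 else 0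

count : ∀ {n} → (Fin n → Bool) → ℕ
count f = sum (indicator ∘ f)

count-cong : ∀ {n} {f g : Fin n → Bool} → f ≗ g → count f ≡ count g
count-cong f≗g = sum-cong-≗ (cong indicator ∘ f≗g)

count-∘-↔ : ∀ {m n} (f : Fin n → Bool) (σ : Fin m ↔ Fin n) → count (f ∘ Inverse.to σ) ≡ count f
count-∘-↔ f σ = sym (sum-permute (indicator ∘ f) σ)

count-false : ∀ n → count {n} (const false) ≡ 0
count-false n = sum-replicate-zero n

count-split : ∀ m {n} (f : Fin (m + n) → Bool) →
              count f ≡ count (f ∘ (_↑ˡ n)) + count (f ∘ (m ↑ʳ_))
count-split zero    f = refl
count-split (suc m) f = trans (cong (indicator (f F.zero) +_) (count-split m (f ∘ F.suc)))
                              (sym (+-assoc (indicator (f F.zero)) _ _))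

≟-injective : ∀ {m n} {f : Fin m → Fin n} → (∀ {x y} → f x ≡ f y → x ≡ y) →
              ∀ x y → ⌊ f x ≟ f y ⌋ ≡ ⌊ x ≟ y ⌋
≟-injective {f = f} f-inj x y with x ≟ y | f x ≟ f y
... | yes _    | yes _     = refl
... | no _     | no _      = refl
... | yes refl | no fx≢fx  = contradiction refl fx≢fx
... | no x≢y   | yes fx≡fy = contradiction (f-inj fx≡fy) x≢y

⌊≟⌋-refl : ∀ {n} (x : Fin n) → ⌊ x ≟ x ⌋ ≡ true
⌊≟⌋-refl x = trans (isYes≗does (x ≟ x)) (dec-true (x ≟ x) refl)

⌊≟⌋-≢ : ∀ {n} {x y : Fin n} → x ≢ y → ⌊ x ≟ y ⌋ ≡ false
⌊≟⌋-≢ {x = x} {y} x≢y = trans (isYes≗does (x ≟ y)) (dec-false (x ≟ y) x≢y)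

count-≟ : ∀ {n} (a : Fin n) → count (λ x → ⌊ x ≟ a ⌋) ≡ 1
count-≟ {suc n} F.zero    = cong suc (count-false n)
count-≟ {suc n} (F.suc a) = trans (count-cong (λ x → ≟-injective suc-injective x a)) (count-≟ a)

deg : (G : Graph) → Fin (order G) → ℕ
deg G x = count (adj G x)

≅-refl : ∀ {G} → G ≅ G
≅-refl = ↔-id _ , λ _ _ → refl

≅-sym : ∀ {G H} → G ≅ H → H ≅ G
≅-sym {G} {H} (σ , adj-σ) = ↔-sym σ , λ x y → sym (begin
  adj G (from x) (from y)           ≡⟨ adj-σ (from x) (from y) ⟩
  adj H (to (from x)) (to (from y)) ≡⟨ cong₂ (adj H) (strictlyInverseˡ x) (strictlyInverseˡ y) ⟩
  adj H x y                         ∎)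
  where open Inverse σ
        open ≡-Reasoning

deg-≅ : ∀ {G H} (σ : G ≅ H) x → deg H (Inverse.to (proj₁ σ) x) ≡ deg G x
deg-≅ {G} {H} (σ , adj-σ) x = begin
  count (adj H (to x))         ≡⟨ count-∘-↔ (adj H (to x)) σ ⟨
  count (adj H (to x) ∘ to)    ≡⟨ count-cong (sym ∘ adj-σ x) ⟩
  count (adj G x)              ∎
  where open Inverse σ
        open ≡-Reasoning

≅-injective : ∀ {G H} (σ : G ≅ H) {x y} → Inverse.to (proj₁ σ) x ≡ Inverse.to (proj₁ σ) y → x ≡ y
≅-injective (σ , _) = Injection.injective (Inverse⇒Injection σ)

Adjacent : (G : Graph) → Fin (order G) → Fin (order G) → Set
Adjacent G x y = x ≢ y × T (adj G x y)

Connected : Graph → Set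
Connected G = ∀ x y → Star (Adjacent G) x y

-- In a delta composition whose triangle vertices are exactly those of degree d,
-- these are the edges outside the triangle.
Adjacent⁻ : (G : Graph) → ℕ → Fin (order G) → Fin (order G) → Set
Adjacent⁻ G d x y = Adjacent G x y × ¬ (deg G x ≡ d × deg G y ≡ d)

≅-Adjacent⁻ : ∀ {G H d} (σ : G ≅ H) {x y} → Adjacent⁻ G d x y →
              Adjacent⁻ H d (Inverse.to (proj₁ σ) x) (Inverse.to (proj₁ σ) y)
≅-Adjacent⁻ {G} {H} σ {x} {y} ((x≢y , xy) , ¬both) =
  (x≢y ∘ ≅-injective {G} {H} σ , subst T (proj₂ σ x y) xy) ,
  λ (dx , dy) → ¬both (trans (sym (deg-≅ {G} {H} σ x)) dx , trans (sym (deg-≅ {G} {H} σ y)) dy)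

record InducedEmbedding (P G : Graph) : Set where
  field
    map       : Fin (order P) → Fin (order G)
    injective : ∀ {x y} → map x ≡ map y → x ≡ y
    adj-map   : ∀ x y → adj G (map x) (map y) ≡ adj P x y

module _ {G H P Q : Graph} (σ : G ≅ H) (e : InducedEmbedding P G) (e′ : InducedEmbedding Q H) where
  private
    module σ = Inverse (proj₁ σ)
    module e = InducedEmbedding e
    module e′ = InducedEmbedding e′

  ≅-restrict : (to-image : ∀ x → ∃ λ y → σ.to (e.map x) ≡ e′.map y) →
               (from-image : ∀ y → ∃ λ x → σ.from (e′.map y) ≡ e.map x) →
               Σ (P ≅ Q) λ τ → ∀ x → e′.map (Inverse.to (proj₁ τ) x) ≡ σ.to (e.map x)
  ≅-restrict to-image from-image = (mk↔ₛ′ f g f∘g g∘f , adj-f) , sym ∘ f-spec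
    where
    f = proj₁ ∘ to-image
    g = proj₁ ∘ from-image
    f-spec : ∀ x → σ.to (e.map x) ≡ e′.map (f x)
    f-spec = proj₂ ∘ to-image
    g-spec : ∀ y → σ.from (e′.map y) ≡ e.map (g y)
    g-spec = proj₂ ∘ from-image
    f∘g : ∀ y → f (g y) ≡ y
    f∘g y = e′.injective (begin
      e′.map (f (g y))          ≡⟨ f-spec (g y) ⟨
      σ.to (e.map (g y))        ≡⟨ cong σ.to (g-spec y) ⟨
      σ.to (σ.from (e′.map y))  ≡⟨ σ.strictlyInverseˡ (e′.map y) ⟩
      e′.map y                  ∎)
      where open ≡-Reasoning
    g∘f : ∀ x → g (f x) ≡ x
    g∘f x = e.injective (begin
      e.map (g (f x))           ≡⟨ g-spec (f x) ⟨
      σ.from (e′.map (f x))     ≡⟨ cong σ.from (f-spec x) ⟨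
      σ.from (σ.to (e.map x))   ≡⟨ σ.strictlyInverseʳ (e.map x) ⟩
      e.map x                   ∎)
      where open ≡-Reasoning
    adj-f : ∀ x y → adj P x y ≡ adj Q (f x) (f y)
    adj-f x y = begin
      adj P x y                                ≡⟨ e.adj-map x y ⟨
      adj G (e.map x) (e.map y)                ≡⟨ proj₂ σ (e.map x) (e.map y) ⟩
      adj H (σ.to (e.map x)) (σ.to (e.map y))  ≡⟨ cong₂ (adj H) (f-spec x) (f-spec y) ⟩
      adj H (e′.map (f x)) (e′.map (f y))      ≡⟨ e′.adj-map (f x) (f y) ⟩
      adj Q (f x) (f y)                        ∎
      where open ≡-Reasoning

↑-cases : ∀ m {n} (i : Fin (m + n)) → (∃ λ x → x ↑ˡ n ≡ i) ⊎ (∃ λ y → m ↑ʳ y ≡ i)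
↑-cases m i with splitAt m i in eq
... | inj₁ x = inj₁ (x , splitAt⁻¹-↑ˡ eq)
... | inj₂ y = inj₂ (y , splitAt⁻¹-↑ʳ eq)

module _ (G H : Graph) where
  private
    m = order G
    n = order H

  ⊕-adj-↑ˡ : ∀ x y → adj (G ⊕ H) (x ↑ˡ n) (y ↑ˡ n) ≡ adj G x y
  ⊕-adj-↑ˡ x y rewrite splitAt-↑ˡ m x n | splitAt-↑ˡ m y n = refl

  ⊕-adj-↑ʳ : ∀ x y → adj (G ⊕ H) (m ↑ʳ x) (m ↑ʳ y) ≡ adj H x y
  ⊕-adj-↑ʳ x y rewrite splitAt-↑ʳ m n x | splitAt-↑ʳ m n y = refl

  ⊕-adj-↑ˡ↑ʳ : ∀ x y → adj (G ⊕ H) (x ↑ˡ n) (m ↑ʳ y) ≡ false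
  ⊕-adj-↑ˡ↑ʳ x y rewrite splitAt-↑ˡ m x n | splitAt-↑ʳ m n y = refl

  ⊕-adj-↑ʳ↑ˡ : ∀ x y → adj (G ⊕ H) (m ↑ʳ x) (y ↑ˡ n) ≡ false
  ⊕-adj-↑ʳ↑ˡ x y rewrite splitAt-↑ʳ m n x | splitAt-↑ˡ m y n = refl

⌊≟⌋-twice-distinct : ∀ {n} (a x y : Fin n) → ⌊ x ≟ a ⌋ ∧ ⌊ y ≟ a ⌋ ∧ not ⌊ x ≟ y ⌋ ≡ false
⌊≟⌋-twice-distinct a x y with x ≟ a | y ≟ a
... | no _     | _        = refl
... | yes _    | no _     = refl
... | yes refl | yes refl = cong (λ b → not b) (⌊≟⌋-refl a)

count-∧-≟ : ∀ {n} b (a : Fin n) → count (λ x → b ∧ ⌊ x ≟ a ⌋) ≡ indicator b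
count-∧-≟ true  a = count-≟ a
count-∧-≟ {n} false a = count-false n

⟨_,_,_⟩ : {A : Set} → A → A → A → Fin 3 → A
⟨ x , y , z ⟩ 0F = x
⟨ x , y , z ⟩ 1F = y
⟨ x , y , z ⟩ 2F = z

module DeltaComposition (Gs : Fin 3 → Graph) (v : ∀ j → Fin (order (Gs j))) where
  private
    n₀ = order (Gs 0F)
    n₁ = order (Gs 1F)
    n₂ = order (Gs 2F)

  G : Graph
  G = delta (Gs 0F) (v 0F) (Gs 1F) (v 1F) (Gs 2F) (v 2F)

  Vertex : Set
  Vertex = Fin (order G)

  embed : ∀ j → Fin (order (Gs j)) → Vertex
  embed 0F x = (x ↑ˡ n₁) ↑ˡ n₂
  embed 1F x = (n₀ ↑ʳ x) ↑ˡ n₂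
  embed 2F x = (n₀ + n₁) ↑ʳ x

  corner : Fin 3 → Vertex
  corner j = embed j (v j)

  decode : Vertex → Σ (Fin 3) (Fin ∘ order ∘ Gs)
  decode a with splitAt (n₀ + n₁) a
  ... | inj₂ z = 2F , z
  ... | inj₁ u with splitAt n₀ u
  ...   | inj₁ x = 0F , x
  ...   | inj₂ y = 1F , y

  decode-embed : ∀ j x → decode (embed j x) ≡ (j , x)
  decode-embed 0F x rewrite splitAt-↑ˡ (n₀ + n₁) (x ↑ˡ n₁) n₂ | splitAt-↑ˡ n₀ x n₁ = refl
  decode-embed 1F x rewrite splitAt-↑ˡ (n₀ + n₁) (n₀ ↑ʳ x) n₂ | splitAt-↑ʳ n₀ n₁ x = refl
  decode-embed 2F x rewrite splitAt-↑ʳ (n₀ + n₁) n₂ x = refl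

  embed-injective : ∀ {j m x y} → embed j x ≡ embed m y → (j , x) ≡ (m , y)
  embed-injective {j} {m} {x} {y} p =
    trans (sym (decode-embed j x)) (trans (cong decode p) (decode-embed m y))

  embed-injectiveʳ : ∀ j {x y} → embed j x ≡ embed j y → x ≡ y
  embed-injectiveʳ j {x} {y} p with embed-injective {j} {j} {x} {y} p
  ... | refl = refl

  embed-disjoint : ∀ {j m x y} → j ≢ m → embed j x ≢ embed m y
  embed-disjoint j≢m p = j≢m (cong proj₁ (embed-injective p))

  embed-surjective : ∀ a → ∃₂ λ j x → embed j x ≡ a
  embed-surjective a with ↑-cases (n₀ + n₁) a
  ... | inj₂ (z , refl) = 2F , z , refl
  ... | inj₁ (u , refl) with ↑-cases n₀ u
  ...   | inj₁ (x , refl) = 0F , x , refl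
  ...   | inj₂ (y , refl) = 1F , y , refl

  private
    U₀₁ U : Graph
    U₀₁ = Gs 0F ⊕ Gs 1F
    U   = U₀₁ ⊕ Gs 2F

  adj-union-same : ∀ j x y → adj U (embed j x) (embed j y) ≡ adj (Gs j) x y
  adj-union-same 0F x y = trans (⊕-adj-↑ˡ U₀₁ (Gs 2F) _ _) (⊕-adj-↑ˡ (Gs 0F) (Gs 1F) x y)
  adj-union-same 1F x y = trans (⊕-adj-↑ˡ U₀₁ (Gs 2F) _ _) (⊕-adj-↑ʳ (Gs 0F) (Gs 1F) x y)
  adj-union-same 2F x y = ⊕-adj-↑ʳ U₀₁ (Gs 2F) x y

  adj-union-distinct : ∀ j m x y → j ≢ m → adj U (embed j x) (embed m y) ≡ false
  adj-union-distinct 0F 0F x y j≢m = contradiction refl j≢m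
  adj-union-distinct 1F 1F x y j≢m = contradiction refl j≢m
  adj-union-distinct 2F 2F x y j≢m = contradiction refl j≢m
  adj-union-distinct 0F 1F x y _ = trans (⊕-adj-↑ˡ U₀₁ (Gs 2F) _ _) (⊕-adj-↑ˡ↑ʳ (Gs 0F) (Gs 1F) x y)
  adj-union-distinct 1F 0F x y _ = trans (⊕-adj-↑ˡ U₀₁ (Gs 2F) _ _) (⊕-adj-↑ʳ↑ˡ (Gs 0F) (Gs 1F) x y)
  adj-union-distinct 0F 2F x y _ = ⊕-adj-↑ˡ↑ʳ U₀₁ (Gs 2F) _ y
  adj-union-distinct 1F 2F x y _ = ⊕-adj-↑ˡ↑ʳ U₀₁ (Gs 2F) _ y
  adj-union-distinct 2F 0F x y _ = ⊕-adj-↑ʳ↑ˡ U₀₁ (Gs 2F) x _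
  adj-union-distinct 2F 1F x y _ = ⊕-adj-↑ʳ↑ˡ U₀₁ (Gs 2F) x _

  ⌊embed≟embed⌋ : ∀ j x y → ⌊ embed j x ≟ embed j y ⌋ ≡ ⌊ x ≟ y ⌋
  ⌊embed≟embed⌋ j = ≟-injective (embed-injectiveʳ j)

  ⌊embed≟embed⌋-distinct : ∀ {j m} x y → j ≢ m → ⌊ embed j x ≟ embed m y ⌋ ≡ false
  ⌊embed≟embed⌋-distinct x y j≢m = ⌊≟⌋-≢ (embed-disjoint j≢m)

  -- The triangle test of delta, so that adj G a b unfolds to
  -- adj U a b ∨ (onTriangle a ∧ onTriangle b ∧ not ⌊ a ≟ b ⌋).
  onTriangle : Vertex → Bool
  onTriangle a = ⌊ a ≟ corner 0F ⌋ ∨ ⌊ a ≟ corner 1F ⌋ ∨ ⌊ a ≟ corner 2F ⌋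

  onTriangle-embed : ∀ j x → onTriangle (embed j x) ≡ ⌊ x ≟ v j ⌋
  onTriangle-embed 0F x
    rewrite ⌊embed≟embed⌋ 0F x (v 0F) | ⌊embed≟embed⌋-distinct {0F} {1F} x (v 1F) (λ ())
          | ⌊embed≟embed⌋-distinct {0F} {2F} x (v 2F) (λ ()) = ∨-identityʳ _
  onTriangle-embed 1F x
    rewrite ⌊embed≟embed⌋ 1F x (v 1F) | ⌊embed≟embed⌋-distinct {1F} {0F} x (v 0F) (λ ())
          | ⌊embed≟embed⌋-distinct {1F} {2F} x (v 2F) (λ ()) = ∨-identityʳ _
  onTriangle-embed 2F x
    rewrite ⌊embed≟embed⌋ 2F x (v 2F) | ⌊embed≟embed⌋-distinct {2F} {0F} x (v 0F) (λ ())
          | ⌊embed≟embed⌋-distinct {2F} {1F} x (v 1F) (λ ()) = refl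

  adj-embed : ∀ j x y → adj G (embed j x) (embed j y) ≡ adj (Gs j) x y
  adj-embed j x y
    rewrite adj-union-same j x y | onTriangle-embed j x | onTriangle-embed j y
          | ⌊embed≟embed⌋ j x y | ⌊≟⌋-twice-distinct (v j) x y = ∨-identityʳ _

  pieceEmbedding : ∀ j → InducedEmbedding (Gs j) G
  pieceEmbedding j = record { map = embed j ; injective = embed-injectiveʳ j ; adj-map = adj-embed j }

  adj-embed-distinct : ∀ j m x y → j ≢ m →
                       adj G (embed j x) (embed m y) ≡ ⌊ x ≟ v j ⌋ ∧ ⌊ y ≟ v m ⌋
  adj-embed-distinct j m x y j≢m
    rewrite adj-union-distinct j m x y j≢m | onTriangle-embed j x | onTriangle-embed m y
          | ⌊embed≟embed⌋-distinct x y j≢m = cong (⌊ x ≟ v j ⌋ ∧_) (∧-identityʳ _)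

  count-by-piece : (f : Vertex → Bool) →
    count f ≡ (count (f ∘ embed 0F) + count (f ∘ embed 1F)) + count (f ∘ embed 2F)
  count-by-piece f = trans (count-split (n₀ + n₁) f) (cong (_+ count (f ∘ embed 2F)) (count-split n₀ _))

  count-adj-embed-distinct : ∀ j m x → j ≢ m →
    count (adj G (embed j x) ∘ embed m) ≡ indicator ⌊ x ≟ v j ⌋
  count-adj-embed-distinct j m x j≢m =
    trans (count-cong (λ y → adj-embed-distinct j m x y j≢m)) (count-∧-≟ ⌊ x ≟ v j ⌋ (v m))

  deg-embed : ∀ j x →
              deg G (embed j x) ≡ deg (Gs j) x + (indicator ⌊ x ≟ v j ⌋ + indicator ⌊ x ≟ v j ⌋)
  deg-embed 0F x
    rewrite count-by-piece (adj G (embed 0F x)) | count-cong (adj-embed 0F x)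
          | count-adj-embed-distinct 0F 1F x (λ ()) | count-adj-embed-distinct 0F 2F x (λ ())
          = +-assoc (deg (Gs 0F) x) _ _
  deg-embed 1F x
    rewrite count-by-piece (adj G (embed 1F x)) | count-cong (adj-embed 1F x)
          | count-adj-embed-distinct 1F 0F x (λ ()) | count-adj-embed-distinct 1F 2F x (λ ())
          = trans (cong (_+ b) (+-comm b (deg (Gs 1F) x))) (+-assoc (deg (Gs 1F) x) b b)
    where b = indicator ⌊ x ≟ v 1F ⌋
  deg-embed 2F x
    rewrite count-by-piece (adj G (embed 2F x)) | count-cong (adj-embed 2F x)
          | count-adj-embed-distinct 2F 0F x (λ ()) | count-adj-embed-distinct 2F 1F x (λ ())
          = +-comm _ (deg (Gs 2F) x)

  deg-corner : ∀ j → deg G (corner j) ≡ deg (Gs j) (v j) + 2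
  deg-corner j rewrite deg-embed j (v j) | ⌊≟⌋-refl (v j) = refl

  deg-embed-≢ : ∀ j x → x ≢ v j → deg G (embed j x) ≡ deg (Gs j) x
  deg-embed-≢ j x x≢v rewrite deg-embed j x | ⌊≟⌋-≢ x≢v = +-identityʳ _

  embed-Adjacent : ∀ j {x y} → Adjacent (Gs j) x y → Adjacent G (embed j x) (embed j y)
  embed-Adjacent j {x} {y} (x≢y , xy) = x≢y ∘ embed-injectiveʳ j , subst T (sym (adj-embed j x y)) xy

  corner-Adjacent : ∀ {j m} → j ≢ m → Adjacent G (corner j) (corner m)
  corner-Adjacent {j} {m} j≢m = embed-disjoint j≢m ,
    subst T (sym (trans (adj-embed-distinct j m (v j) (v m) j≢m)
                        (cong₂ _∧_ (⌊≟⌋-refl (v j)) (⌊≟⌋-refl (v m))))) _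

  connected : (∀ j → Connected (Gs j)) → Connected G
  connected conn a b with embed-surjective a | embed-surjective b
  ... | j , x , refl | m , y , refl =
    gmap (embed j) (embed-Adjacent j) (conn j x (v j)) ◅◅ between j m ◅◅
    gmap (embed m) (embed-Adjacent m) (conn m (v m) y)
    where
    between : ∀ j m → Star (Adjacent G) (corner j) (corner m)
    between j m with j ≟ m
    ... | yes refl = ε
    ... | no j≢m   = corner-Adjacent j≢m ◅ ε

record Rooted (k D : ℕ) : Set where
  field
    graph       : Graph
    root        : Fin (order graph)
    inΔ         : InΔ k graph
    deg≤        : ∀ x → deg graph x ≤ D
    deg-root    : deg graph root ≡ D
    isConnected : Connected graph
open Rooted public

module Composition {k D : ℕ} (Rs : Fin 3 → Rooted k D) where
  open DeltaComposition (graph ∘ Rs) (root ∘ Rs) public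

  deg-corner-max : ∀ j → deg G (corner j) ≡ 2 + D
  deg-corner-max j = trans (deg-corner j) (trans (cong (_+ 2) (deg-root (Rs j))) (+-comm D 2))

  deg-max⇒root : ∀ j x → deg G (embed j x) ≡ 2 + D → x ≡ root (Rs j)
  deg-max⇒root j x d≡ with x ≟ root (Rs j)
  ... | yes x≡v = x≡v
  ... | no x≢v  = contradiction (subst (_≤ D) (trans (sym (deg-embed-≢ j x x≢v)) d≡) (deg≤ (Rs j) x))
                                (1+n≰n ∘ ≤-trans (n≤1+n (suc D)))

  deg-max⇒corner : ∀ a → deg G a ≡ 2 + D → ∃ λ j → a ≡ corner j
  deg-max⇒corner a d≡ with embed-surjective a
  ... | j , x , refl = j , cong (embed j) (deg-max⇒root j x d≡)

  deg≤-max : ∀ a → deg G a ≤ 2 + D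
  deg≤-max a with embed-surjective a
  ... | j , x , refl with x ≟ root (Rs j)
  ...   | yes refl = ≤-reflexive (deg-corner-max j)
  ...   | no x≢v   = ≤-trans (≤-reflexive (deg-embed-≢ j x x≢v)) (≤-trans (deg≤ (Rs j) x) (m≤n+m D 2))

  embed-Adjacent⁻ : ∀ j {x y} → Adjacent (graph (Rs j)) x y → Adjacent⁻ G (2 + D) (embed j x) (embed j y)
  embed-Adjacent⁻ j {x} {y} xy@(x≢y , _) = embed-Adjacent j xy ,
    λ (dx , dy) → x≢y (trans (deg-max⇒root j x dx) (sym (deg-max⇒root j y dy)))

  Adjacent⁻-stays-in-piece : ∀ j x {a} → Adjacent⁻ G (2 + D) (embed j x) a → ∃ λ y → a ≡ embed j y
  Adjacent⁻-stays-in-piece j x {a} ((_ , xa) , ¬both) with embed-surjective a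
  ... | m , y , refl with j ≟ m
  ...   | yes refl = y , refl
  ...   | no j≢m   = contradiction (deg-max-at x≡v , deg-max-at y≡v) ¬both
    where
    corners : T ⌊ x ≟ root (Rs j) ⌋ × T ⌊ y ≟ root (Rs m) ⌋
    corners = Equivalence.to T-∧ (subst T (adj-embed-distinct j m x y j≢m) xa)
    x≡v = toWitness (proj₁ corners)
    y≡v = toWitness (proj₂ corners)
    deg-max-at : ∀ {i z} → z ≡ root (Rs i) → deg G (embed i z) ≡ 2 + D
    deg-max-at {i} refl = deg-corner-max i

  walk-stays-in-piece : ∀ j x {a} → Star (Adjacent⁻ G (2 + D)) (embed j x) a → ∃ λ y → a ≡ embed j y
  walk-stays-in-piece j x ε = x , refl
  walk-stays-in-piece j x (step ◅ walk) with Adjacent⁻-stays-in-piece j x step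
  ... | y , refl = walk-stays-in-piece j y walk

  compose : Rooted (suc k) (2 + D)
  compose = record
    { graph       = G
    ; root        = corner 0F
    ; inΔ         = graph (Rs 0F) , graph (Rs 1F) , graph (Rs 2F) , inΔ (Rs 0F) , inΔ (Rs 1F) , inΔ (Rs 2F)
                  , root (Rs 0F) , root (Rs 1F) , root (Rs 2F) , ≅-refl
    ; deg≤        = deg≤-max
    ; deg-root    = deg-corner-max 0F
    ; isConnected = connected (isConnected ∘ Rs)
    }

open Composition using (compose) public

_≅ᵣ_ : ∀ {k D k′ D′} → Rooted k D → Rooted k′ D′ → Set
A ≅ᵣ B = Σ (graph A ≅ graph B) λ σ → Inverse.to (proj₁ σ) (root A) ≡ root B

≅ᵣ-sym : ∀ {k D k′ D′} {A : Rooted k D} {B : Rooted k′ D′} → A ≅ᵣ B → B ≅ᵣ A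
≅ᵣ-sym {A = A} {B} (σ , root↦root) =
  ≅-sym {graph A} {graph B} σ , trans (cong from (sym root↦root)) (strictlyInverseʳ (root A))
  where open Inverse (proj₁ σ)

module CompositionIsomorphism {k D} (Rs Rs′ : Fin 3 → Rooted k D)
                              (σ : graph (compose Rs) ≅ graph (compose Rs′)) where
  private
    module A = Composition Rs
    module B = Composition Rs′
    to = Inverse.to (proj₁ σ)

  corner-image : ∀ j → ∃ λ m → to (A.corner j) ≡ B.corner m
  corner-image j = B.deg-max⇒corner _ (trans (deg-≅ {A.G} {B.G} σ (A.corner j)) (A.deg-corner-max j))

  piece-image : ∀ {j m} → to (A.corner j) ≡ B.corner m → ∀ x → ∃ λ y → to (A.embed j x) ≡ B.embed m y
  piece-image {j} {m} corner↦corner x = B.walk-stays-in-piece m (root (Rs′ m))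
    (subst (λ c → Star (Adjacent⁻ B.G (2 + D)) c (to (A.embed j x))) corner↦corner
      (gmap to (≅-Adjacent⁻ {A.G} {B.G} σ)
        (gmap (A.embed j) (A.embed-Adjacent⁻ j) (isConnected (Rs j) (root (Rs j)) x))))

corner-≅ᵣ : ∀ {k D} (Rs Rs′ : Fin 3 → Rooted k D)
            (σ : graph (compose Rs) ≅ graph (compose Rs′)) {j m} →
            Inverse.to (proj₁ σ) (Composition.corner Rs j) ≡ Composition.corner Rs′ m → Rs j ≅ᵣ Rs′ m
corner-≅ᵣ Rs Rs′ σ {j} {m} corner↦corner =
  τ , B.embed-injectiveʳ m (trans (τ-spec (root (Rs j))) corner↦corner)
  where
  module A = Composition Rs
  module B = Composition Rs′
  open Inverse (proj₁ σ)
  σ⁻¹ = ≅-sym {A.G} {B.G} σ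
  corner↤corner : from (B.corner m) ≡ A.corner j
  corner↤corner = trans (cong from (sym corner↦corner)) (strictlyInverseʳ (A.corner j))
  restricted = ≅-restrict σ (A.pieceEmbedding j) (B.pieceEmbedding m)
    (CompositionIsomorphism.piece-image Rs Rs′ σ corner↦corner)
    (CompositionIsomorphism.piece-image Rs′ Rs σ⁻¹ corner↤corner)
  τ = proj₁ restricted
  τ-spec = proj₂ restricted

module _ {k D} {Rs Rs′ : Fin 3 → Rooted k D} where

  compose-≅⇒pieces : graph (compose Rs) ≅ graph (compose Rs′) → ∀ j → ∃ λ m → Rs j ≅ᵣ Rs′ m
  compose-≅⇒pieces σ j with CompositionIsomorphism.corner-image Rs Rs′ σ j
  ... | m , corner↦corner = m , corner-≅ᵣ Rs Rs′ σ corner↦corner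

  compose-≅ᵣ⇒root : compose Rs ≅ᵣ compose Rs′ → Rs 0F ≅ᵣ Rs′ 0F
  compose-≅ᵣ⇒root (σ , root↦root) = corner-≅ᵣ Rs Rs′ σ root↦root

  compose-≅ᵣ⇒nonroot : compose Rs ≅ᵣ compose Rs′ → ∀ j → j ≢ 0F → ∃ λ m → m ≢ 0F × Rs j ≅ᵣ Rs′ m
  compose-≅ᵣ⇒nonroot (σ , root↦root) j j≢0 with CompositionIsomorphism.corner-image Rs Rs′ σ j
  ... | m , corner↦corner with m ≟ 0F
  ...   | no m≢0    = m , m≢0 , corner-≅ᵣ Rs Rs′ σ corner↦corner
  ...   | yes refl  = contradiction (≅-injective {graph (compose Rs)} {graph (compose Rs′)} σ
                                       (trans corner↦corner (sym root↦root)))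
                                    (Composition.embed-disjoint Rs j≢0)

Distinct : ∀ {k D} {I : Set} → (I → Rooted k D) → Set
Distinct F = ∀ i j → F i ≅ᵣ F j → i ≡ j

Apart : ∀ {k D} {I J : Set} → (I → Rooted k D) → (J → Rooted k D) → Set
Apart F F′ = ∀ i j → ¬ F i ≅ᵣ F′ j

Distinct-∘ : ∀ {k D} {I J : Set} {F : I → Rooted k D} → Distinct F →
             {g : J → I} → (∀ {x y} → g x ≡ g y → x ≡ y) → Distinct (F ∘ g)
Distinct-∘ distinct g-inj i j r = g-inj (distinct _ _ r)

module _ {k D} {A B C : Set} {F₀ : A → Rooted k D} {F₁ : B → Rooted k D} {F₂ : C → Rooted k D} where

  compose-distinct : Distinct F₀ → Distinct F₁ → Distinct F₂ → Apart F₁ F₂ →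
                     Distinct (λ ((a , b , c) : A × B × C) → compose ⟨ F₀ a , F₁ b , F₂ c ⟩)
  compose-distinct distinct₀ distinct₁ distinct₂ apart (a , b , c) (a′ , b′ , c′) r =
    cong₂ _,_ (distinct₀ a a′ (compose-≅ᵣ⇒root {Rs = Rs} {Rs′} r))
              (cong₂ _,_ (second (compose-≅ᵣ⇒nonroot {Rs = Rs} {Rs′} r 1F (λ ())))
                         (third (compose-≅ᵣ⇒nonroot {Rs = Rs} {Rs′} r 2F (λ ()))))
    where
    Rs : Fin 3 → Rooted k D
    Rs = ⟨ F₀ a , F₁ b , F₂ c ⟩
    Rs′ : Fin 3 → Rooted k D
    Rs′ = ⟨ F₀ a′ , F₁ b′ , F₂ c′ ⟩
    second : (∃ λ m → m ≢ 0F × F₁ b ≅ᵣ Rs′ m) → b ≡ b′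
    second (0F , m≢0 , _) = contradiction refl m≢0
    second (1F , _ , r₁)  = distinct₁ b b′ r₁
    second (2F , _ , r₁)  = contradiction r₁ (apart b c′)
    third : (∃ λ m → m ≢ 0F × F₂ c ≅ᵣ Rs′ m) → c ≡ c′
    third (0F , m≢0 , _) = contradiction refl m≢0
    third (1F , _ , r₂)  = contradiction (≅ᵣ-sym {A = F₂ c} {F₁ b′} r₂) (apart b′ c)
    third (2F , _ , r₂)  = distinct₂ c c′ r₂

record NonIsomorphicMembers (k L : ℕ) : Set where
  field
    graphs        : List Graph
    inΔs          : All (InΔ k) graphs
    nonIsomorphic : AllPairs (λ G H → ¬ (G ≅ H)) graphs
    length≡       : length graphs ≡ L

module _ {k D n m} {P : Fin n → Rooted k D} {Q : Fin m → Rooted k D} where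

  twinComposition : Fin n × Fin m → Rooted (suc k) (2 + D)
  twinComposition (a , b) = compose ⟨ P a , Q b , Q b ⟩

  twinComposition-injective : Distinct P → Distinct Q → Apart P Q →
    ∀ i j → graph (twinComposition i) ≅ graph (twinComposition j) → i ≡ j
  twinComposition-injective distinctP distinctQ apart (a , b) (a′ , b′) σ =
    cong₂ _,_ (first (compose-≅⇒pieces {Rs = Rs} {Rs′} σ 0F))
              (second (compose-≅⇒pieces {Rs = Rs} {Rs′} σ 1F))
    where
    Rs Rs′ : Fin 3 → Rooted k D
    Rs = ⟨ P a , Q b , Q b ⟩
    Rs′ = ⟨ P a′ , Q b′ , Q b′ ⟩
    first : (∃ λ j → P a ≅ᵣ Rs′ j) → a ≡ a′
    first (0F , r) = distinctP a a′ r
    first (1F , r) = contradiction r (apart a b′)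
    first (2F , r) = contradiction r (apart a b′)
    second : (∃ λ j → Q b ≅ᵣ Rs′ j) → b ≡ b′
    second (0F , r) = contradiction (≅ᵣ-sym {A = Q b} {P a′} r) (apart a′ b)
    second (1F , r) = distinctQ b b′ r
    second (2F , r) = distinctQ b b′ r

  twinCompositions : Distinct P → Distinct Q → Apart P Q → NonIsomorphicMembers (suc k) (n * m)
  twinCompositions distinctP distinctQ apart = record
    { graphs        = tabulate G
    ; inΔs          = All.tabulate⁺ (inΔ ∘ twinComposition ∘ index)
    ; nonIsomorphic = AllPairs.tabulate⁺ λ i≢j σ →
                        i≢j (index-injective (twinComposition-injective distinctP distinctQ apart _ _ σ))
    ; length≡       = length-tabulate G
    }
    where
    index = Inverse.to (*↔× {n} {m})
    index-injective = Injection.injective (Inverse⇒Injection (*↔× {n} {m}))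
    G = graph ∘ twinComposition ∘ index

-- The first index splits a family into two classes.  Filling the second and third
-- pieces of a composition from different classes keeps an isomorphism from swapping them.
record Family (k D n : ℕ) : Set where
  field
    member   : Fin 2 × Fin n → Rooted k D
    distinct : Distinct member
open Family

class-distinct : ∀ {k D n} (F : Family k D n) c → Distinct (member F ∘ (c ,_))
class-distinct F c = Distinct-∘ {F = member F} (distinct F) (cong proj₂)

classes-apart : ∀ {k D n} (F : Family k D n) → Apart (member F ∘ (0F ,_)) (member F ∘ (1F ,_))
classes-apart F b c r with distinct F _ _ r
... | ()

cube : ℕ → ℕ
cube n = n * (n * n)

family-step : ∀ {k D n} → Family k D n → Family (suc k) (2 + D) (cube n)
family-step {k} {D} {n} F = record
  { member   = composed ∘ Inverse.to regroup
  ; distinct = Distinct-∘ {F = composed}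
                 (compose-distinct {F₀ = member F} {member F ∘ (0F ,_)} {member F ∘ (1F ,_)}
                   (distinct F) (class-distinct F 0F) (class-distinct F 1F) (classes-apart F))
                 (Injection.injective (Inverse⇒Injection regroup))
  }
  where
  composed : (Fin 2 × Fin n) × Fin n × Fin n → Rooted (suc k) (2 + D)
  composed (i , b , c) = compose ⟨ member F i , member F (0F , b) , member F (1F , c) ⟩
  regroup : (Fin 2 × Fin (cube n)) ↔ ((Fin 2 × Fin n) × Fin n × Fin n)
  regroup = ↔-sym (×-assoc 0ℓ _ _ _) ↔-∘ (↔-id _ ×-↔ ((↔-id _ ×-↔ *↔×) ↔-∘ *↔×))

countDegree : Graph → ℕ → ℕ
countDegree G d = count (λ x → deg G x ≡ᵇ d)

countDegree-≅ : ∀ {G H} → G ≅ H → ∀ d → countDegree G d ≡ countDegree H d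
countDegree-≅ {G} {H} σ d =
  trans (count-cong (λ x → cong (_≡ᵇ d) (sym (deg-≅ {G} {H} σ x))))
        (count-∘-↔ (λ y → deg H y ≡ᵇ d) (proj₁ σ))

K₂-rooted : Rooted 0 1
K₂-rooted = record
  { graph       = K₂
  ; root        = 0F
  ; inΔ         = ≅-refl
  ; deg≤        = λ { 0F → ≤-refl ; 1F → ≤-refl }
  ; deg-root    = refl
  ; isConnected = λ { 0F 0F → ε ; 0F 1F → ((λ ()) , _) ◅ ε ; 1F 0F → ((λ ()) , _) ◅ ε ; 1F 1F → ε }
  }

net : Rooted 1 3
net = compose (λ _ → K₂-rooted)

module NetsAt (y z : Fin (order (graph net))) = DeltaComposition (λ _ → graph net) ⟨ 0F , y , z ⟩

-- The root is a triangle vertex of the first net; y and z are either triangle vertices (0F)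
-- or leaves (1F) of the other two.
netsAt : ∀ y z → (∀ x → deg (NetsAt.G y z) x ≤ 5) → Rooted 2 5
netsAt y z deg≤5 = record
  { graph       = G
  ; root        = corner 0F
  ; inΔ         = graph net , graph net , graph net , inΔ net , inΔ net , inΔ net , 0F , y , z , ≅-refl
  ; deg≤        = deg≤5
  ; deg-root    = trans (deg-corner 0F) (cong (_+ 2) (deg-root net))
  ; isConnected = connected (λ _ → isConnected net)
  }
  where open NetsAt y z

-- Opaque, so that unification never unfolds these concrete 18-vertex graphs.
opaque
  level2 : Fin 3 → Rooted 2 5
  level2 0F = netsAt 0F 0F (toWitness {a? = all? λ x → deg (NetsAt.G 0F 0F) x ≤? 5} _)
  level2 1F = netsAt 0F 1F (toWitness {a? = all? λ x → deg (NetsAt.G 0F 1F) x ≤? 5} _)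
  level2 2F = netsAt 1F 1F (toWitness {a? = all? λ x → deg (NetsAt.G 1F 1F) x ≤? 5} _)

  -- The three graphs have 3, 2 and 1 vertices of degree 5 respectively.
  level2-≅-injective : ∀ i j → graph (level2 i) ≅ graph (level2 j) → i ≡ j
  level2-≅-injective i j σ = by-countDegree i j (countDegree-≅ {graph (level2 i)} {graph (level2 j)} σ 5)
    where
    by-countDegree : ∀ i j → countDegree (graph (level2 i)) 5 ≡ countDegree (graph (level2 j)) 5 → i ≡ j
    by-countDegree 0F 0F _ = refl
    by-countDegree 1F 1F _ = refl
    by-countDegree 2F 2F _ = refl
    by-countDegree 0F 1F ()
    by-countDegree 0F 2F ()
    by-countDegree 1F 0F ()
    by-countDegree 1F 2F ()
    by-countDegree 2F 0F ()
    by-countDegree 2F 1F ()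

level2-distinct : Distinct level2
level2-distinct i j (σ , _) = level2-≅-injective i j σ

family₃ : Family 3 7 2
family₃ = record
  { member   = outerMiddleOuter ∘ λ (a , c) → a , tt , c
  ; distinct = Distinct-∘ {F = outerMiddleOuter}
                 (compose-distinct {F₀ = level2 ∘ outer} {λ _ → level2 1F} {level2 ∘ outer}
                    outer-distinct (λ _ _ _ → refl) outer-distinct middle-apart)
                 (λ p → cong₂ _,_ (cong proj₁ p) (cong (proj₂ ∘ proj₂) p))
  }
  where
  outer : Fin 2 → Fin 3
  outer 0F = 0F
  outer 1F = 2F
  outer-injective : ∀ {a c} → outer a ≡ outer c → a ≡ c
  outer-injective {0F} {0F} _ = refl
  outer-injective {1F} {1F} _ = refl
  outer-injective {0F} {1F} ()
  outer-injective {1F} {0F} ()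
  outer-distinct : Distinct (level2 ∘ outer)
  outer-distinct = Distinct-∘ {F = level2} level2-distinct outer-injective
  middle-apart : Apart {J = Fin 2} (λ (_ : ⊤) → level2 1F) (level2 ∘ outer)
  middle-apart _ 0F r with level2-distinct 1F 0F r
  ... | ()
  middle-apart _ 1F r with level2-distinct 1F 2F r
  ... | ()
  outerMiddleOuter : Fin 2 × ⊤ × Fin 2 → Rooted 3 7
  outerMiddleOuter (a , _ , c) = compose ⟨ level2 (outer a) , level2 1F , level2 (outer c) ⟩

cubes : ℕ → ℕ
cubes zero    = 2
cubes (suc i) = cube (cubes i)

families : ∀ i → ∃ λ D → Family (3 + i) D (cubes i)
families zero    = 7 , family₃
families (suc i) = Product.map (2 +_) family-step (families i)

members₂ : NonIsomorphicMembers 2 2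
members₂ = record
  { graphs        = graph (level2 0F) ∷ graph (level2 2F) ∷ []
  ; inΔs          = inΔ (level2 0F) ∷ inΔ (level2 2F) ∷ []
  ; nonIsomorphic = (nonIso ∷ []) ∷ [] ∷ []
  ; length≡       = refl
  }
  where
  nonIso : ¬ (graph (level2 0F) ≅ graph (level2 2F))
  nonIso σ with level2-≅-injective 0F 2F σ
  ... | ()

members₃ : NonIsomorphicMembers 3 2
members₃ = twinCompositions {P = λ (_ : Fin 1) → level2 0F} {Q = level2 ∘ F.suc}
             (λ { 0F 0F _ → refl }) (Distinct-∘ {F = level2} level2-distinct suc-injective) apart
  where
  apart : Apart (λ (_ : Fin 1) → level2 0F) (level2 ∘ F.suc)
  apart _ j r with level2-distinct 0F (F.suc j) r
  ... | ()

members₄₊ : ∀ i → NonIsomorphicMembers (4 + i) (cubes i * cubes i)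
members₄₊ i = twinCompositions {P = member F ∘ (0F ,_)} {Q = member F ∘ (1F ,_)}
                (class-distinct F 0F) (class-distinct F 1F) (classes-apart F)
  where F = proj₂ (families i)

cube-^ : ∀ a → cube (2 ^ a) ≡ 2 ^ (3 * a)
cube-^ a = begin
  2 ^ a * (2 ^ a * 2 ^ a)        ≡⟨ cong (λ t → 2 ^ a * (2 ^ a * t)) (cong (2 ^_) (+-identityʳ a)) ⟨
  2 ^ a * (2 ^ a * 2 ^ (a + 0))  ≡⟨ cong (2 ^ a *_) (^-distribˡ-+-* 2 a (a + 0)) ⟨
  2 ^ a * 2 ^ (a + (a + 0))      ≡⟨ ^-distribˡ-+-* 2 a (a + (a + 0)) ⟨
  2 ^ (3 * a)                    ∎
  where open ≡-Reasoning

cubes-^ : ∀ i → cubes i ≡ 2 ^ 3 ^ i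
cubes-^ zero    = refl
cubes-^ (suc i) = trans (cong cube (cubes-^ i)) (cube-^ (3 ^ i))

cubes²-bound : ∀ i → 2 ^ (1 * 3 ^ (4 + i)) ≤ (cubes i * cubes i) ^ 81
cubes²-bound i = begin
  2 ^ (1 * 3 ^ (4 + i))       ≡⟨ cong (2 ^_) (trans (*-identityˡ _)
                                   (trans (^-distribˡ-+-* 3 4 i) (*-comm 81 a))) ⟩
  2 ^ (a * 81)                ≤⟨ ^-monoʳ-≤ 2 (*-monoˡ-≤ 81 (m≤m+n a a)) ⟩
  2 ^ ((a + a) * 81)          ≡⟨ ^-*-assoc 2 (a + a) 81 ⟨
  (2 ^ (a + a)) ^ 81          ≡⟨ cong (_^ 81) (^-distribˡ-+-* 2 a a) ⟩
  (2 ^ a * 2 ^ a) ^ 81        ≡⟨ cong (λ c → (c * c) ^ 81) (cubes-^ i) ⟨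
  (cubes i * cubes i) ^ 81    ∎
  where
  a = 3 ^ i
  open ≤-Reasoning

ManyNonIsomorphic : ℕ → Set
ManyNonIsomorphic k = Σ (List Graph) λ Gs →
  All (InΔ k) Gs × AllPairs (λ G H → ¬ (G ≅ H)) Gs × 2 ^ (1 * 3 ^ k) ≤ length Gs ^ 81

manyNonIsomorphic : ∀ {k L} → NonIsomorphicMembers k L → 2 ^ (1 * 3 ^ k) ≤ L ^ 81 → ManyNonIsomorphic k
manyNonIsomorphic M bound = graphs , inΔs , nonIsomorphic , subst (λ L → _ ≤ L ^ 81) (sym length≡) bound
  where open NonIsomorphicMembers M

members : ∀ k → 2 ≤ k → ManyNonIsomorphic k
members 0 ()
members 1 (s≤s ())
members 2 _ = manyNonIsomorphic members₂ (^-monoʳ-≤ 2 (≤ᵇ⇒≤ 9 81 _))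
members 3 _ = manyNonIsomorphic members₃ (^-monoʳ-≤ 2 (≤ᵇ⇒≤ 27 81 _))
members (suc (suc (suc (suc i)))) _ = manyNonIsomorphic (members₄₊ i) (cubes²-bound i)

proposition5p6 : Σ ℕ λ p → Σ ℕ λ q → 1 ≤ p × 1 ≤ q ×
    (∀ k → 2 ≤ k → Σ (List Graph) λ Gs →
      All (InΔ k) Gs × AllPairs (λ G H → ¬ (G ≅ H)) Gs ×
      2 ^ (p * 3 ^ k) ≤ length Gs ^ q)
proposition5p6 = 1 , 81 , ≤-refl , s≤s z≤n , members
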